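{- Let $a,b$ be coprime positive integers. For all $D,D'\in\mathbb{Z}^b$, if $D\approx D'$ then $D+K=D'+K$.
   Context: Write $[b]=\{1,\dots,b\}$; chip configurations are vectors $D=(D(1),\dots,D(b))\in\mathbb{Z}^b$. For $S\subseteq[b]$ with $|S|=s$, the cluster-fire move $\phi_S$ subtracts $1+\lfloor (b-s)a/b\rfloor$ from $D(i)$ for $i\in S$ and adds $\lfloor sa/b\rfloor$ to $D(j)$ for $j\in[b]\setminus S$ ($\phi_\varnothing$ the identity); the borrow move is $\beta_S=\phi_S^{ -1}$. $D\approx D'$ means $D$ can be converted to $D'$ by a finite sequence of (not necessarily legal) cluster-fire and borrow moves. $K$ is the subgroup of $\mathbb{Z}^b$ generated by $a\mathbf{e}_1,\dots,a\mathbf{e}_b$ and $\mathbf{1}=(1,\dots,1)$, where $\mathbf{e}_j$ is the $j$th standard basis vector. -}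

module Defs where

open import Data.Nat using (ℕ; _∸_; _/_; suc; NonZero) renaming (_*_ to _*ℕ_)
open import Data.Integer using (ℤ; +_; _+_; _-_; _*_)
open import Data.Fin using (Fin)
open import Data.Fin.Subset using (Subset; ∣_∣)
open import Data.Fin.Subset.Properties using (_∈?_)
open import Data.Product using (Σ; _×_)
open import Relation.Nullary using (yes; no)
open import Relation.Binary.PropositionalEquality using (_≡_)
open import Relation.Binary.Construct.Closure.ReflexiveTransitive using (Star)

Config : ℕ → Set
Config b = Fin b → ℤ

module _ (a b : ℕ) .{{_ : NonZero b}} where

  loss : ℕ → ℕ
  loss s = suc (((b ∸ s) *ℕ a) / b)

  gain : ℕ → ℕ
  gain s = (s *ℕ a) / b

  fire : Subset b → Config b → Config b
  fire S D i with i ∈? S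
  ... | yes _ = D i - + loss ∣ S ∣
  ... | no  _ = D i + + gain ∣ S ∣

  borrow : Subset b → Config b → Config b
  borrow S D i with i ∈? S
  ... | yes _ = D i + + loss ∣ S ∣
  ... | no  _ = D i - + gain ∣ S ∣

  -- one (not necessarily legal) cluster-fire or borrow move
  data Move : Config b → Config b → Set where
    fireM   : ∀ S D → Move D (fire S D)
    borrowM : ∀ S D → Move D (borrow S D)

  Equiv : Config b → Config b → Set
  Equiv = Star Move

-- membership in K = ⟨ a e_1, …, a e_b, 1 ⟩ ⊆ ℤ^b
InK : (a : ℕ) {b : ℕ} → Config b → Set
InK a {b} v = Σ (Fin b → ℤ) λ c → Σ ℤ λ m → ∀ i → v i ≡ (+ a) * c i + m

InCoset : (a : ℕ) {b : ℕ} → Config b → Config b → Set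
InCoset a D E = Σ (Config _) λ k → InK a k × (∀ i → E i ≡ D i + k i)

{-# OPTIONS --safe #-}
-- Every move shifts a configuration by a vector of K, so ≈-equivalent
-- configurations lie in the same coset of K. A cluster-fire on S changes D by
-- −loss on S and by +gain off S. If S = ∅ or S = [b] this shift is constant.
-- Otherwise 0 < s < b, so b ∤ sa by coprimality; since (b − s)a + sa = ab, the
-- two floors then add up to a − 1, i.e. loss + gain = a, and the shift is
-- −loss·𝟏 + a·𝟏_{[b]∖S} ∈ K.
module Submission where

open import Defs
open import Data.Nat using (ℕ; NonZero)
open import Data.Nat.Coprimality using (Coprime)
open import Function.Bundles using (_⇔_)

open import Data.Nat as ℕ using (suc; _∸_; _/_; _%_; _<_; z≤n; s≤s; ≢-nonZero)
import Data.Nat.Properties as ℕ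
import Data.Nat.Tactic.RingSolver as ℕ-Solver
open import Data.Nat.DivMod using (m≡m%n+[m/n]*n; m%n<n)
open import Data.Nat.Divisibility using (_∣_; m%n≡0⇒n∣m; ∣⇒≤)
import Data.Nat.Coprimality as Coprimality
open import Data.Integer using (ℤ; +_; _+_; _-_; _*_; -_)
import Data.Integer.Properties as ℤ
import Data.Integer.Tactic.RingSolver as ℤ-Solver
open import Data.Fin using (Fin)
open import Data.Fin.Subset using (Subset; ∣_∣; _∈_; _∉_)
open import Data.Fin.Subset.Properties using (_∈?_; nonempty?; ∣p∣≤n; ∣p∣≤∣x∷p∣; ∣p∣≡n⇒p≡⊤; ∈⊤)
open import Data.Vec.Base using (_∷_; here; there)
open import Data.Product using (_,_)
open import Data.Sum using (_⊎_; inj₁; inj₂)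
open import Relation.Nullary using (yes; no; contradiction)
open import Relation.Binary.PropositionalEquality
open import Relation.Binary.Construct.Closure.ReflexiveTransitive using (fold)
open import Function.Bundles using (mk⇔)

x∈p⇒0<∣p∣ : ∀ {n} {x : Fin n} {p : Subset n} → x ∈ p → 0 < ∣ p ∣
x∈p⇒0<∣p∣ here                  = s≤s z≤n
x∈p⇒0<∣p∣ {p = s ∷ p} (there x∈p) = ℕ.≤-trans (x∈p⇒0<∣p∣ x∈p) (∣p∣≤∣x∷p∣ s p)

x∉p⇒∣p∣<n : ∀ {n} {x : Fin n} {p : Subset n} → x ∉ p → ∣ p ∣ < n
x∉p⇒∣p∣<n {x = x} {p} x∉p =
  ℕ.≤∧≢⇒< (∣p∣≤n p) (λ ∣p∣≡n → x∉p (subst (x ∈_) (sym (∣p∣≡n⇒p≡⊤ ∣p∣≡n)) ∈⊤))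

r+q*b≡n*b⇒1+q≡n : ∀ {r q n b} → 0 < r → r < b ℕ.+ b → r ℕ.+ q ℕ.* b ≡ n ℕ.* b → suc q ≡ n
r+q*b≡n*b⇒1+q≡n {r} {q} {n} {b} 0<r r<2b eq = ℕ.≤-antisym q<n (ℕ.≤-pred n<2+q)
  where
  q<n : q < n
  q<n = ℕ.*-cancelʳ-< b q n (subst (q ℕ.* b <_) eq (ℕ.m<n+m (q ℕ.* b) 0<r))
  n<2+q : n < suc (suc q)
  n<2+q = ℕ.*-cancelʳ-< b n (suc (suc q)) (begin-strict
    n ℕ.* b             ≡⟨ sym eq ⟩
    r ℕ.+ q ℕ.* b       <⟨ ℕ.+-monoˡ-< (q ℕ.* b) r<2b ⟩
    b ℕ.+ b ℕ.+ q ℕ.* b ≡⟨ ℕ.+-assoc b b (q ℕ.* b) ⟩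
    suc (suc q) ℕ.* b   ∎)
    where open ℕ.≤-Reasoning

-- The remainders of m and n sum to a positive multiple of d below 2d, hence to d.
m+n≡k*d⇒1+m/d+n/d≡k : ∀ m n k d .{{_ : NonZero d}} →
                      m ℕ.+ n ≡ k ℕ.* d → n % d ≢ 0 → suc (m / d ℕ.+ n / d) ≡ k
m+n≡k*d⇒1+m/d+n/d≡k m n k d m+n≡kd n%d≢0 =
  r+q*b≡n*b⇒1+q≡n (ℕ.<-≤-trans (ℕ.n≢0⇒n>0 n%d≢0) (ℕ.m≤n+m (n % d) (m % d)))
                  (ℕ.+-mono-< (m%n<n m d) (m%n<n n d))
                  (begin
                    m % d ℕ.+ n % d ℕ.+ (m / d ℕ.+ n / d) ℕ.* d
                      ≡⟨ regroup (m % d) (n % d) (m / d) (n / d) d ⟩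
                    (m % d ℕ.+ m / d ℕ.* d) ℕ.+ (n % d ℕ.+ n / d ℕ.* d)
                      ≡⟨ sym (cong₂ ℕ._+_ (m≡m%n+[m/n]*n m d) (m≡m%n+[m/n]*n n d)) ⟩
                    m ℕ.+ n
                      ≡⟨ m+n≡kd ⟩
                    k ℕ.* d ∎)
  where
  open ≡-Reasoning
  regroup : ∀ r r′ q q′ d → r ℕ.+ r′ ℕ.+ (q ℕ.+ q′) ℕ.* d ≡ (r ℕ.+ q ℕ.* d) ℕ.+ (r′ ℕ.+ q′ ℕ.* d)
  regroup = ℕ-Solver.solve-∀

loss+gain≡a : ∀ a b .{{_ : NonZero b}} → Coprime a b → ∀ {s} → 0 < s → s < b →
              loss a b s ℕ.+ gain a b s ≡ a
loss+gain≡a a b cop {s} 0<s s<b =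
  m+n≡k*d⇒1+m/d+n/d≡k ((b ∸ s) ℕ.* a) (s ℕ.* a) a b (begin
    (b ∸ s) ℕ.* a ℕ.+ s ℕ.* a ≡⟨ sym (ℕ.*-distribʳ-+ a (b ∸ s) s) ⟩
    (b ∸ s ℕ.+ s) ℕ.* a       ≡⟨ cong (ℕ._* a) (ℕ.m∸n+n≡m (ℕ.<⇒≤ s<b)) ⟩
    b ℕ.* a                   ≡⟨ ℕ.*-comm b a ⟩
    a ℕ.* b                   ∎) b∤s*a
  where
  open ≡-Reasoning
  b∤s*a : s ℕ.* a % b ≢ 0
  b∤s*a s*a%b≡0 = ℕ.<⇒≱ s<b (∣⇒≤ {{≢-nonZero (ℕ.m<n⇒n≢0 0<s)}} b∣s)
    where
    b∣s : b ∣ s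
    b∣s = Coprimality.coprime-divisor (Coprimality.sym cop)
            (subst (b ∣_) (ℕ.*-comm s a) (m%n≡0⇒n∣m (s ℕ.* a) b s*a%b≡0))

module _ (a : ℕ) {b : ℕ} where

  InK-twoValued : ∀ m {v : Config b} → (∀ i → v i ≡ m ⊎ v i ≡ + a + m) → InK a v
  InK-twoValued m v∈ = (λ i → coeff (v∈ i)) , m , λ i → coeff-correct (v∈ i)
    where
    coeff : ∀ {x} → x ≡ m ⊎ x ≡ + a + m → ℤ
    coeff (inj₁ _) = + 0
    coeff (inj₂ _) = + 1
    coeff-correct : ∀ {x} (x∈ : x ≡ m ⊎ x ≡ + a + m) → x ≡ + a * coeff x∈ + m
    coeff-correct (inj₁ x≡m)   =
      trans x≡m (sym (trans (cong (_+ m) (ℤ.*-zeroʳ (+ a))) (ℤ.+-identityˡ m)))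
    coeff-correct (inj₂ x≡a+m) = trans x≡a+m (cong (_+ m) (sym (ℤ.*-identityʳ (+ a))))

  InK-+ : ∀ {u v : Config b} → InK a u → InK a v → InK a (λ i → u i + v i)
  InK-+ (c , m , u≡) (c′ , m′ , v≡) = (λ i → c i + c′ i) , m + m′ , λ i →
    trans (cong₂ _+_ (u≡ i) (v≡ i)) (regroup (+ a) (c i) m (c′ i) m′)
    where
    regroup : ∀ A c m c′ m′ → (A * c + m) + (A * c′ + m′) ≡ A * (c + c′) + (m + m′)
    regroup = ℤ-Solver.solve-∀

  InK-neg : ∀ {u : Config b} → InK a u → InK a (λ i → - u i)
  InK-neg (c , m , u≡) = (λ i → - c i) , - m , λ i →
    trans (cong -_ (u≡ i)) (negate (+ a) (c i) m)
    where
    negate : ∀ A c m → - (A * c + m) ≡ A * (- c) + (- m)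
    negate = ℤ-Solver.solve-∀

  InCoset-refl : ∀ {D : Config b} → InCoset a D D
  InCoset-refl {D} =
    (λ _ → + 0) , InK-twoValued (+ 0) (λ _ → inj₁ refl) , λ i → sym (ℤ.+-identityʳ (D i))

  InCoset-trans : ∀ {D D′ E : Config b} → InCoset a D D′ → InCoset a D′ E → InCoset a D E
  InCoset-trans {D} {D′} {E} (k , k∈K , D′≡) (k′ , k′∈K , E≡) =
    (λ i → k i + k′ i) , InK-+ k∈K k′∈K , λ i → begin
      E i                 ≡⟨ E≡ i ⟩
      D′ i + k′ i         ≡⟨ cong (_+ k′ i) (D′≡ i) ⟩
      D i + k i + k′ i    ≡⟨ ℤ.+-assoc (D i) (k i) (k′ i) ⟩
      D i + (k i + k′ i)  ∎
    where open ≡-Reasoning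

  InCoset-sym : ∀ {D D′ : Config b} → InCoset a D D′ → InCoset a D′ D
  InCoset-sym {D} {D′} (k , k∈K , D′≡) = (λ i → - k i) , InK-neg k∈K , λ i → begin
    D i               ≡⟨ cancel (D i) (k i) ⟩
    D i + k i - k i   ≡⟨ cong (_- k i) (sym (D′≡ i)) ⟩
    D′ i - k i        ∎
    where
    open ≡-Reasoning
    cancel : ∀ d k → d ≡ d + k - k
    cancel = ℤ-Solver.solve-∀

module _ (a b : ℕ) .{{_ : NonZero b}} where

  fireShift : Subset b → Config b
  fireShift S i with i ∈? S
  ... | yes _ = - + loss a b ∣ S ∣
  ... | no  _ = + gain a b ∣ S ∣

  fire≡+fireShift : ∀ S D i → fire a b S D i ≡ D i + fireShift S i
  fire≡+fireShift S D i with i ∈? S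
  ... | yes _ = refl
  ... | no  _ = refl

  borrow≡-fireShift : ∀ S D i → borrow a b S D i ≡ D i - fireShift S i
  borrow≡-fireShift S D i with i ∈? S
  ... | yes _ = cong (_+_ (D i)) (sym (ℤ.neg-involutive _))
  ... | no  _ = refl

  InK-fireShift : Coprime a b → ∀ S → InK a (fireShift S)
  InK-fireShift cop S with nonempty? S
  ... | no S-empty = InK-twoValued a (+ gain a b ∣ S ∣) constant
    where
    constant : ∀ i → fireShift S i ≡ + gain a b ∣ S ∣ ⊎ fireShift S i ≡ + a + + gain a b ∣ S ∣
    constant i with i ∈? S
    ... | yes i∈S = contradiction (i , i∈S) S-empty
    ... | no  _   = inj₁ refl
  ... | yes (_ , j∈S) = InK-twoValued a (- + l) twoValued
    where
    l g : ℕ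
    l = loss a b ∣ S ∣
    g = gain a b ∣ S ∣
    twoValued : ∀ i → fireShift S i ≡ - + l ⊎ fireShift S i ≡ + a - + l
    twoValued i with i ∈? S
    ... | yes _   = inj₁ refl
    ... | no  i∉S = inj₂ (begin
      + g                ≡⟨ cancel (+ l) (+ g) ⟩
      + l + + g - + l    ≡⟨ cong (_- + l) (sym (ℤ.pos-+ l g)) ⟩
      + (l ℕ.+ g) - + l  ≡⟨ cong (λ x → + x - + l) l+g≡a ⟩
      + a - + l          ∎)
      where
      open ≡-Reasoning
      l+g≡a : l ℕ.+ g ≡ a
      l+g≡a = loss+gain≡a a b cop (x∈p⇒0<∣p∣ j∈S) (x∉p⇒∣p∣<n i∉S)
      cancel : ∀ l g → g ≡ l + g - l
      cancel = ℤ-Solver.solve-∀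

  Move⇒InCoset : Coprime a b → ∀ {D D′} → Move a b D D′ → InCoset a D D′
  Move⇒InCoset cop (fireM S D)   = fireShift S , InK-fireShift cop S , fire≡+fireShift S D
  Move⇒InCoset cop (borrowM S D) =
    (λ i → - fireShift S i) , InK-neg a (InK-fireShift cop S) , borrow≡-fireShift S D

  Equiv⇒InCoset : Coprime a b → ∀ {D D′} → Equiv a b D D′ → InCoset a D D′
  Equiv⇒InCoset cop =
    fold (InCoset a) (λ {D} move → InCoset-trans a {D = D} (Move⇒InCoset cop move)) (InCoset-refl a)

lemma5p1 : (a b : ℕ) .{{_ : NonZero a}} .{{_ : NonZero b}} → Coprime a b →
    (D D' : Config b) → Equiv a b D D' →
    (∀ E → InCoset a D E ⇔ InCoset a D' E)
lemma5p1 a b cop D D' D≈D' E =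
  mk⇔ (InCoset-trans a {D = D'} (InCoset-sym a {D = D} D′∈D+K)) (InCoset-trans a {D = D} D′∈D+K)
  where
  D′∈D+K : InCoset a D D'
  D′∈D+K = Equiv⇒InCoset a b cop D≈D'
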